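{- Let $w$ be a string of length $n$ over a finite alphabet, with suffix array $r$ and inverse permutation $p$ (so $p[r[i]]=i$). Let $u$ be a substring of $w$ that is maximal to the right and occurs exactly $k\ge 2$ times in $w$, and let $i$ ($1\le i<n$) be the index such that the suffixes of $w$ having $u$ as a prefix are exactly $w[r[t]..n]$ for $t=i,i+1,\dots,i+k-1$. Then $u$ is maximal to the left if and only if at least one of the following holds: $r[i]=1$; or $r[i+k-1]=1$; or ($r[i]>1$, $r[i+k-1]>1$ and $w[r[i]-1]\neq w[r[i+k-1]-1]$); or ($r[i]>1$, $r[i+k-1]>1$ and $p[r[i+k-1]-1]-p[r[i]-1]\neq k-1$).
   Context: Positions of a string $w$ are numbered $1,\dots,|w|$, $w[i]$ is the symbol at position $i$, and $w[i..j]$ is the substring from position $i$ to $j$ inclusive. A substring $u$ occurs in $w$ at position $i$ if $u=w[i..i+|u|-1]$. An extension to the right (resp. left) of $u$ is a string $uv$ (resp. $vu$) with $v$ nonempty. A substring $u$ is maximal to the right (resp. left) if every extension to the right (resp. left) of $u$ occurs in $w$ fewer times than $u$. The suffix array $r$ of $w$ is the permutation of $\{1,\dots,n\}$ such that for $i<j$ the suffix $w[r[i]..n]$ is lexicographically smaller than $w[r[j]..n]$; $p$ is its inverse permutation. -}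

module Defs where

open import Data.Nat using (ℕ; zero; suc; _+_; _∸_; _≤_; _<_)
open import Data.Fin as Fin using (Fin)
open import Data.Fin.Properties using () renaming (_≟_ to _≟ᶠ_)
open import Data.List using (List; []; _∷_; length; take; drop; filter; upTo; map; _++_)
open import Data.List.Properties using (≡-dec)
open import Data.List.Relation.Binary.Lex.Strict using (Lex-<)
open import Data.Maybe using (Maybe; just; nothing)
open import Data.Product using (_×_)
open import Relation.Binary.PropositionalEquality using (_≡_)
open import Relation.Nullary using (¬_)

-- Strings over the finite alphabet Fin σ, positions numbered 1..|w|.
Str : ℕ → Set
Str σ = List (Fin σ)

suffix : ∀ {σ} → Str σ → ℕ → Str σ
suffix w i = drop (i ∸ 1) w

symAt : ∀ {σ} → Str σ → ℕ → Maybe (Fin σ)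
symAt w i with suffix w i
... | []    = nothing
... | a ∷ _ = just a

OccursAt : ∀ {σ} → Str σ → Str σ → ℕ → Set
OccursAt w u i = (1 ≤ i) × (i + length u ∸ 1 ≤ length w) × (take (length u) (suffix w i) ≡ u)

-- number of occurrences: positions i ∈ {1..n} where u = w[i..i+|u|-1]
-- (for i in 1..n, i + |u| - 1 ≤ n is equivalent to take giving back u)
occ : ∀ {σ} → Str σ → Str σ → ℕ
occ {σ} w u =
  length (filter (λ i → ≡-dec _≟ᶠ_ (take (length u) (suffix w i)) u)
                 (map suc (upTo (length w))))

NonEmpty : ∀ {σ} → Str σ → Set
NonEmpty v = ¬ (v ≡ [])

MaximalRight : ∀ {σ} → Str σ → Str σ → Set
MaximalRight {σ} w u = (v : Str σ) → NonEmpty v → occ w (u ++ v) < occ w u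

MaximalLeft : ∀ {σ} → Str σ → Str σ → Set
MaximalLeft {σ} w u = (v : Str σ) → NonEmpty v → occ w (v ++ u) < occ w u

_<ˡᵉˣ_ : ∀ {σ} → Str σ → Str σ → Set
_<ˡᵉˣ_ = Lex-< _≡_ Fin._<_

-- r (as a function on ℕ, meaningful on 1..n) is the suffix array of w
IsSuffixArray : ∀ {σ} → Str σ → (ℕ → ℕ) → Set
IsSuffixArray w r =
  (∀ i → 1 ≤ i → i ≤ length w → (1 ≤ r i) × (r i ≤ length w)) ×
  (∀ i j → 1 ≤ i → i ≤ length w → 1 ≤ j → j ≤ length w → r i ≡ r j → i ≡ j) ×
  (∀ i j → 1 ≤ i → i < j → j ≤ length w → suffix w (r i) <ˡᵉˣ suffix w (r j))

IsInverse : ℕ → (ℕ → ℕ) → (ℕ → ℕ) → Set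
IsInverse n r p =
  (∀ i → 1 ≤ i → i ≤ n → (1 ≤ p i) × (p i ≤ n)) ×
  (∀ i → 1 ≤ i → i ≤ n → p (r i) ≡ i) ×
  (∀ i → 1 ≤ i → i ≤ n → r (p i) ≡ i)

module Submission where

-- Every counting argument below is an injection into the list of occurrence
-- positions of a string: a duplicate-free list of occurrences is never longer
-- than that list.  Three consequences carry the proof.
--   * Prepending a letter a to u sends an occurrence z of a ∷ u to the
--     occurrence z + 1 of u, so occ (a ∷ u) ≤ occ u, strictly if some
--     occurrence of u starts at position 1 or is preceded by a letter ≠ a.
--     Hence u is maximal to the left iff occ (a ∷ u) < occ u for every a.
--   * The suffixes having a fixed prefix form an interval of the suffix
--     array, so if ranks s ≤ t both carry prefix x then t - s + 1 ≤ occ x.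
--   * Prepending the same letter preserves the order of two suffixes.
-- For the theorem, the occurrences of u sit at ranks i..e (e = i + k - 1).
-- If both ends are preceded by the same letter a and their left extensions
-- have ranks k - 1 apart, then a ∷ u fills k ranks, so u is not left
-- maximal.  Conversely, if u is not left maximal, some letter a precedes all
-- k occurrences; the k extended suffixes then have increasing ranks lying in
-- a block of at most k ranks, so their ranks are exactly k - 1 apart and none
-- of the four boundary conditions holds.

open import Defs
open import Data.Nat using (ℕ; zero; suc; _+_; _∸_; _⊓_; _≤_; _<_; _>_; z≤n; s≤s; s≤s⁻¹)
open import Data.Nat.Properties
open import Data.Integer using (+_; _-_; _⊖_)
import Data.Integer.Properties as ℤ
open import Data.Fin as Fin using (Fin)
import Data.Fin.Properties as Fin
open import Data.List using (List; []; _∷_; length; take; drop; filter; upTo; map; _++_; applyUpTo; head)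
open import Data.List.Properties using (≡-dec; ∷-injectiveˡ; ∷-injectiveʳ; length-map; length-applyUpTo; length-++; length-take; length-drop; ++-identityʳ)
open import Data.List.Relation.Binary.Lex.Strict using (this; next; <-asymmetric)
import Data.List.Relation.Unary.All as All
open import Data.List.Relation.Unary.AllPairs using (_∷_)
open import Data.List.Relation.Unary.Any using (here; there)
open import Data.List.Relation.Unary.Unique.Propositional using (Unique)
import Data.List.Relation.Unary.Unique.Propositional.Properties as Unique
open import Data.List.Membership.Propositional using (_∈_; _∉_)
open import Data.List.Membership.Propositional.Properties using (∈-map⁺; ∈-map⁻; ∈-upTo⁺; ∈-upTo⁻; ∈-applyUpTo⁺; ∈-applyUpTo⁻; ∈-filter⁺; ∈-filter⁻; ∈-∃++; ∈-++⁻; ∈-++⁺ˡ; ∈-++⁺ʳ)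
open import Data.List.Relation.Binary.Subset.Propositional using (_⊆_)
open import Data.Maybe using (just)
import Data.Maybe.Properties as Maybe
open import Data.Product using (_×_; _,_; proj₁; proj₂; ∃)
open import Data.Sum using (_⊎_; inj₁; inj₂)
open import Data.Empty using (⊥-elim)
open import Function.Bundles using (_⇔_; mk⇔; Equivalence)
open import Relation.Nullary using (¬_; Dec; yes; no; ¬?)
open import Relation.Nullary.Decidable using (_⊎-dec_; _×-dec_; decidable-stable)
open import Relation.Binary.Definitions using (tri<; tri≈; tri>)
open import Relation.Binary.PropositionalEquality

shifted-index : ∀ {s t j} → s ≤ suc t → j < suc t ∸ s → s + j ≤ t
shifted-index {s} {t} {j} s≤t+1 j<m =
  ≤-pred (subst (s + j <_) (m+[n∸m]≡n s≤t+1) (+-monoʳ-< s j<m))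

suc-difference : ∀ x d → suc (x + d) ∸ x ≡ suc d
suc-difference x d = trans (cong (_∸ x) (sym (+-suc x d))) (m+n∸m≡n x (suc d))

difference-to-ℕ : ∀ x y d → (+ x) - (+ y) ≡ + d → x ≡ y + d
difference-to-ℕ x y d eq = go x y (trans (sym (ℤ.[+m]-[+n]≡m⊖n x y)) eq)
  where
  go : ∀ x y → x ⊖ y ≡ + d → x ≡ y + d
  go zero    zero    eq = ℤ.+-injective eq
  go (suc x) zero    eq = ℤ.+-injective eq
  go (suc x) (suc y) eq = cong suc (go x y (trans (sym (ℤ.[1+m]⊖[1+n]≡m⊖n x y)) eq))

difference-from-ℕ : ∀ x y d → x ≡ y + d → (+ x) - (+ y) ≡ + d
difference-from-ℕ _ y d refl = begin
  (+ (y + d)) - (+ y)  ≡⟨ ℤ.[+m]-[+n]≡m⊖n (y + d) y ⟩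
  (y + d) ⊖ y          ≡⟨ ℤ.⊖-≥ (m≤m+n y d) ⟩
  + (y + d ∸ y)        ≡⟨ cong +_ (m+n∸m≡n y d) ⟩
  + d                  ∎
  where open ≡-Reasoning

empty-or-nonempty : ∀ {σ} (x : Str σ) → x ≡ [] ⊎ NonEmpty x
empty-or-nonempty []      = inj₁ refl
empty-or-nonempty (_ ∷ _) = inj₂ (λ ())

unique-⊆-length : ∀ {A : Set} {xs ys : List A} → Unique xs → xs ⊆ ys → length xs ≤ length ys
unique-⊆-length {xs = []} _ _ = z≤n
unique-⊆-length {xs = x ∷ xs} (x∉xs ∷ xs-unique) xs⊆ys with ∈-∃++ (xs⊆ys (here refl))
... | as , bs , refl = begin
  suc (length xs)             ≤⟨ s≤s (unique-⊆-length xs-unique xs⊆as++bs) ⟩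
  suc (length (as ++ bs))     ≡⟨ cong suc (length-++ as) ⟩
  suc (length as + length bs) ≡⟨ sym (+-suc (length as) (length bs)) ⟩
  length as + length (x ∷ bs) ≡⟨ sym (length-++ as) ⟩
  length (as ++ x ∷ bs)       ∎
  where
  open ≤-Reasoning
  xs⊆as++bs : xs ⊆ as ++ bs
  xs⊆as++bs z∈xs with ∈-++⁻ as (xs⊆ys (there z∈xs))
  ... | inj₁ z∈as          = ∈-++⁺ˡ z∈as
  ... | inj₂ (here refl)   = ⊥-elim (All.lookup x∉xs z∈xs refl)
  ... | inj₂ (there z∈bs)  = ∈-++⁺ʳ as z∈bs

positions : ℕ → List ℕ
positions n = map suc (upTo n)

∈-positions⁻ : ∀ {n z} → z ∈ positions n → 1 ≤ z × z ≤ n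
∈-positions⁻ z∈ with ∈-map⁻ suc z∈
... | y , y∈ , refl = s≤s z≤n , ∈-upTo⁻ y∈

∈-positions⁺ : ∀ {n z} → 1 ≤ z → z ≤ n → z ∈ positions n
∈-positions⁺ {z = suc y} _ y<n = ∈-map⁺ suc (∈-upTo⁺ y<n)

IsPrefix : ∀ {σ} → Str σ → Str σ → Set
IsPrefix x s = take (length x) s ≡ x

IsOcc : ∀ {σ} → Str σ → Str σ → ℕ → Set
IsOcc w x z = 1 ≤ z × z ≤ length w × IsPrefix x (suffix w z)

Occurrences : ∀ {σ} → Str σ → Str σ → List ℕ
Occurrences w x = filter (λ z → ≡-dec Fin._≟_ (take (length x) (suffix w z)) x) (positions (length w))

module _ {σ} {w x : Str σ} where

  ∈-occurrences⁻ : ∀ {z} → z ∈ Occurrences w x → IsOcc w x z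
  ∈-occurrences⁻ z∈ with ∈-filter⁻ _ z∈
  ... | z∈positions , prefix with ∈-positions⁻ z∈positions
  ... | z≥1 , z≤len = z≥1 , z≤len , prefix

  ∈-occurrences⁺ : ∀ {z} → IsOcc w x z → z ∈ Occurrences w x
  ∈-occurrences⁺ (z≥1 , z≤len , prefix) = ∈-filter⁺ _ (∈-positions⁺ z≥1 z≤len) prefix

  occurrences-unique : Unique (Occurrences w x)
  occurrences-unique = Unique.filter⁺ _ (Unique.map⁺ suc-injective (Unique.upTo⁺ (length w)))

  occ-≥ : ∀ {zs} → Unique zs → (∀ {z} → z ∈ zs → IsOcc w x z) → length zs ≤ occ w x
  occ-≥ zs-unique all-occ = unique-⊆-length zs-unique (λ z∈ → ∈-occurrences⁺ (all-occ z∈))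

  occ-> : ∀ {zs j} → Unique zs → (∀ {z} → z ∈ zs → IsOcc w x z) → IsOcc w x j → j ∉ zs →
          length zs < occ w x
  occ-> {zs} {j} zs-unique all-occ j-occ j∉zs =
    occ-≥ (All.tabulate j≢ ∷ zs-unique) λ { (here refl) → j-occ ; (there z∈) → all-occ z∈ }
    where
    j≢ : ∀ {z} → z ∈ zs → j ≢ z
    j≢ z∈ refl = j∉zs z∈

  occ-≤ : ∀ {ys} → (∀ {z} → IsOcc w x z → z ∈ ys) → occ w x ≤ length ys
  occ-≤ covers = unique-⊆-length occurrences-unique (λ z∈ → covers (∈-occurrences⁻ z∈))

symAt-head : ∀ {σ} (w : Str σ) z → symAt w z ≡ head (suffix w z)
symAt-head w z with suffix w z
... | []    = refl
... | _ ∷ _ = refl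

drop-∷⁻ : ∀ {A : Set} m (xs : List A) {a s} → drop m xs ≡ a ∷ s → m < length xs × drop (suc m) xs ≡ s
drop-∷⁻ zero    (_ ∷ xs) refl = s≤s z≤n , refl
drop-∷⁻ (suc m) (_ ∷ xs) eq with drop-∷⁻ m xs eq
... | m<n , next≡s = s≤s m<n , next≡s

letter-exists : ∀ {σ} (w : Str σ) z → 1 ≤ z → z ≤ length w → ∃ λ a → symAt w z ≡ just a
letter-exists w (suc z) _ z<n = go w z z<n
  where
  go : ∀ xs m → m < length xs → ∃ λ a → symAt xs (suc m) ≡ just a
  go (a ∷ _)  zero    _         = a , refl
  go (_ ∷ xs) (suc m) (s≤s m<n) = go xs m m<n

suffix-preceded : ∀ {σ} (w : Str σ) y {a} → 2 ≤ y → symAt w (y ∸ 1) ≡ just a →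
                  suffix w (y ∸ 1) ≡ a ∷ suffix w y
suffix-preceded w (suc zero) (s≤s ())
suffix-preceded w (suc (suc z)) {a} _ letter =
  go (drop z w) refl (trans (sym (symAt-head w (suc z))) letter)
  where
  go : ∀ s → drop z w ≡ s → head s ≡ just a → s ≡ a ∷ drop (suc z) w
  go []      _  ()
  go (b ∷ s) dz refl = cong (b ∷_) (sym (proj₂ (drop-∷⁻ z w dz)))

letter-of-prefix : ∀ {σ} (w : Str σ) z {a x} → IsPrefix (a ∷ x) (suffix w z) → symAt w z ≡ just a
letter-of-prefix w z prefix = trans (symAt-head w z) (go (suffix w z) prefix)
  where
  go : ∀ {a x} s → IsPrefix (a ∷ x) s → head s ≡ just a
  go []      ()
  go (b ∷ s) prefix = cong just (∷-injectiveˡ prefix)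

occ-occursAt : ∀ {σ} {w x : Str σ} {z} → IsOcc w x z → OccursAt w x z
occ-occursAt {w = w} {x} {suc z} (z≥1 , z≤len , prefix) = z≥1 , fits , prefix
  where
  open ≤-Reasoning
  fits : z + length x ≤ length w
  fits = begin
    z + length x                               ≡⟨ cong (λ s → z + length s) (sym prefix) ⟩
    z + length (take (length x) (drop z w))    ≡⟨ cong (λ m → z + m) (length-take (length x) (drop z w)) ⟩
    z + (length x ⊓ length (drop z w))         ≤⟨ +-monoʳ-≤ z (m⊓n≤n (length x) _) ⟩
    z + length (drop z w)                      ≡⟨ cong (λ m → z + m) (length-drop z w) ⟩
    z + (length w ∸ z)                         ≡⟨ m+[n∸m]≡n (<⇒≤ z≤len) ⟩
    length w                                   ∎

module _ {σ} (w : Str σ) {x : Str σ} (a : Fin σ) where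

  occ-shift : NonEmpty x → ∀ {z} → IsOcc w (a ∷ x) z → IsOcc w x (suc z)
  occ-shift x≢[] {suc z} (_ , _ , prefix) = go x (drop z w) refl x≢[] prefix
    where
    go : ∀ y s → drop z w ≡ s → NonEmpty y → IsPrefix (a ∷ y) s → IsOcc w y (suc (suc z))
    go []      _           _  y≢[] _      = ⊥-elim (y≢[] refl)
    go (c ∷ y) []          _  _    ()
    go (c ∷ y) (b ∷ [])    _  _    ()
    go (c ∷ y) (b ∷ d ∷ s) dz _    prefix =
      s≤s z≤n , proj₁ (drop-∷⁻ (suc z) w dz′) , subst (IsPrefix (c ∷ y)) (sym dz′) (∷-injectiveʳ prefix)
      where
      dz′ : drop (suc z) w ≡ d ∷ s
      dz′ = proj₂ (drop-∷⁻ z w dz)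

  shifted : List ℕ
  shifted = map suc (Occurrences w (a ∷ x))

  shifted-occ : NonEmpty x → ∀ {z} → z ∈ shifted → IsOcc w x z
  shifted-occ x≢[] z∈ with ∈-map⁻ suc z∈
  ... | _ , z∈occ , refl = occ-shift x≢[] (∈-occurrences⁻ z∈occ)

  shifted-length : length shifted ≡ occ w (a ∷ x)
  shifted-length = length-map suc (Occurrences w (a ∷ x))

  shifted-unique : Unique shifted
  shifted-unique = Unique.map⁺ suc-injective (occurrences-unique {w = w} {x = a ∷ x})

  occ-cons-≤ : NonEmpty x → occ w (a ∷ x) ≤ occ w x
  occ-cons-≤ x≢[] = subst (_≤ occ w x) shifted-length (occ-≥ shifted-unique (shifted-occ x≢[]))

  occ-cons-< : NonEmpty x → ∀ {j} → IsOcc w x j → (j ≡ 1 ⊎ symAt w (j ∸ 1) ≢ just a) →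
               occ w (a ∷ x) < occ w x
  occ-cons-< x≢[] {j} j-occ fresh =
    subst (_< occ w x) shifted-length (occ-> shifted-unique (shifted-occ x≢[]) j-occ j∉shifted)
    where
    j∉shifted : j ∉ shifted
    j∉shifted j∈ with ∈-map⁻ suc j∈
    ... | z , z∈occ , refl = excluded fresh (∈-occurrences⁻ z∈occ)
      where
      excluded : (suc z ≡ 1 ⊎ symAt w z ≢ just a) → ¬ IsOcc w (a ∷ x) z
      excluded (inj₁ refl)  (() , _ , _)
      excluded (inj₂ not-a) (_ , _ , prefix) = not-a (letter-of-prefix w z prefix)

module _ {σ} (w : Str σ) where

  maximalLeft-from-letters : ∀ {u} → (∀ a → occ w (a ∷ u) < occ w u) → MaximalLeft w u
  maximalLeft-from-letters fewer []          v≢[] = ⊥-elim (v≢[] refl)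
  maximalLeft-from-letters fewer (a ∷ [])    _    = fewer a
  maximalLeft-from-letters fewer (a ∷ b ∷ v) _    =
    ≤-<-trans (occ-cons-≤ w a (λ ())) (maximalLeft-from-letters fewer (b ∷ v) (λ ()))

  maximalLeft-empty : MaximalRight w [] → MaximalLeft w []
  maximalLeft-empty mr v v≢[] = subst (λ y → occ w y < occ w []) (sym (++-identityʳ v)) (mr v v≢[])

module _ {σ : ℕ} where

  lex-asym : ∀ {xs ys : Str σ} → xs <ˡᵉˣ ys → ¬ ys <ˡᵉˣ xs
  lex-asym = <-asymmetric sym (resp₂ Fin._<_) Fin.<-asym

  _≤ˡᵉˣ_ : Str σ → Str σ → Set
  xs ≤ˡᵉˣ ys = xs <ˡᵉˣ ys ⊎ xs ≡ ys

  prefix-convex-strict : ∀ (x s₁ s₂ s₃ : Str σ) → IsPrefix x s₁ → IsPrefix x s₃ →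
                         s₁ <ˡᵉˣ s₂ → s₂ <ˡᵉˣ s₃ → IsPrefix x s₂
  prefix-convex-strict []      _         _         _         _  _  _   _   = refl
  prefix-convex-strict (c ∷ x) []        _         _         () _  _   _
  prefix-convex-strict (c ∷ x) (_ ∷ _)   _         []        _  () _   _
  prefix-convex-strict (c ∷ x) (_ ∷ _)   []        (_ ∷ _)   _  _  ()  _
  prefix-convex-strict (c ∷ x) (c₁ ∷ s₁) (c₂ ∷ s₂) (c₃ ∷ s₃) p₁ p₃ l₁₂ l₂₃
    with ∷-injectiveˡ p₁ | ∷-injectiveˡ p₃ | l₁₂ | l₂₃
  ... | refl | refl | this c<c₂    | this c₂<c    = ⊥-elim (Fin.<-asym c<c₂ c₂<c)
  ... | refl | refl | this c<c     | next refl _  = ⊥-elim (Fin.<-irrefl refl c<c)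
  ... | refl | refl | next refl _  | this c<c     = ⊥-elim (Fin.<-irrefl refl c<c)
  ... | refl | refl | next refl l  | next refl l′ =
    cong (c ∷_) (prefix-convex-strict x s₁ s₂ s₃ (∷-injectiveʳ p₁) (∷-injectiveʳ p₃) l l′)

  prefix-convex : ∀ {x s₁ s₂ s₃ : Str σ} → IsPrefix x s₁ → IsPrefix x s₃ →
                  s₁ ≤ˡᵉˣ s₂ → s₂ ≤ˡᵉˣ s₃ → IsPrefix x s₂
  prefix-convex p₁ p₃ (inj₂ refl) _           = p₁
  prefix-convex p₁ p₃ (inj₁ _)    (inj₂ refl) = p₃
  prefix-convex p₁ p₃ (inj₁ l₁₂)  (inj₁ l₂₃)  = prefix-convex-strict _ _ _ _ p₁ p₃ l₁₂ l₂₃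

module SuffixArray {σ} (w : Str σ) (r p : ℕ → ℕ) (sa : IsSuffixArray w r) (inv : IsInverse (length w) r p) where

  n : ℕ
  n = length w

  r-range : ∀ t → 1 ≤ t → t ≤ n → 1 ≤ r t × r t ≤ n
  r-range = proj₁ sa

  r-injective : ∀ s t → 1 ≤ s → s ≤ n → 1 ≤ t → t ≤ n → r s ≡ r t → s ≡ t
  r-injective = proj₁ (proj₂ sa)

  r-sorted : ∀ s t → 1 ≤ s → s < t → t ≤ n → suffix w (r s) <ˡᵉˣ suffix w (r t)
  r-sorted = proj₂ (proj₂ sa)

  p-range : ∀ z → 1 ≤ z → z ≤ n → 1 ≤ p z × p z ≤ n
  p-range = proj₁ inv

  r∘p : ∀ z → 1 ≤ z → z ≤ n → r (p z) ≡ z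
  r∘p = proj₂ (proj₂ inv)

  r-monotone : ∀ s t → 1 ≤ s → s ≤ t → t ≤ n → suffix w (r s) ≤ˡᵉˣ suffix w (r t)
  r-monotone s t s≥1 s≤t t≤n with s ≟ t
  ... | yes refl = inj₂ refl
  ... | no s≢t   = inj₁ (r-sorted s t s≥1 (≤∧≢⇒< s≤t s≢t) t≤n)

  p-reflects : ∀ y z → 1 ≤ y → y ≤ n → 1 ≤ z → z ≤ n → suffix w y <ˡᵉˣ suffix w z → p y < p z
  p-reflects y z y≥1 y≤n z≥1 z≤len y<z with <-cmp (p y) (p z) | p-range y y≥1 y≤n | p-range z z≥1 z≤len
  ... | tri< py<pz _ _ | _ | _ = py<pz
  ... | tri≈ _ py≡pz _ | _ | _ =
    ⊥-elim (lex-asym y<y y<y)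
    where
    y≡z : y ≡ z
    y≡z = trans (sym (r∘p y y≥1 y≤n)) (trans (cong r py≡pz) (r∘p z z≥1 z≤len))
    y<y : suffix w y <ˡᵉˣ suffix w y
    y<y = subst (λ v → suffix w y <ˡᵉˣ suffix w v) (sym y≡z) y<z
  ... | tri> _ _ pz<py | pyr | (pz≥1 , _) =
    ⊥-elim (lex-asym y<z (subst₂ (λ u v → suffix w u <ˡᵉˣ suffix w v) (r∘p z z≥1 z≤len) (r∘p y y≥1 y≤n)
                                  (r-sorted (p z) (p y) pz≥1 pz<py (proj₂ pyr))))

  interval-count : ∀ {x} s t → 1 ≤ s → s ≤ t → t ≤ n →
                   IsPrefix x (suffix w (r s)) → IsPrefix x (suffix w (r t)) → suc t ∸ s ≤ occ w x
  interval-count {x} s t s≥1 s≤t t≤n prefix-s prefix-t =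
    subst (_≤ occ w x) (length-applyUpTo rank m) (occ-≥ distinct all-occ)
    where
    m : ℕ
    m = suc t ∸ s
    rank : ℕ → ℕ
    rank j = r (s + j)
    inside : ∀ {j} → j < m → 1 ≤ s + j × s + j ≤ n
    inside j<m = ≤-trans s≥1 (m≤m+n s _) , ≤-trans (shifted-index (m≤n⇒m≤1+n s≤t) j<m) t≤n
    distinct : Unique (applyUpTo rank m)
    distinct = Unique.applyUpTo⁺₁ rank m λ {j} {j′} j<j′ j′<m eq →
      <-irrefl (+-cancelˡ-≡ s j j′ (r-injective (s + j) (s + j′)
                  (proj₁ (inside (<-trans j<j′ j′<m))) (proj₂ (inside (<-trans j<j′ j′<m)))
                  (proj₁ (inside j′<m)) (proj₂ (inside j′<m)) eq)) j<j′
    all-occ : ∀ {z} → z ∈ applyUpTo rank m → IsOcc w x z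
    all-occ z∈ with ∈-applyUpTo⁻ rank z∈
    ... | j , j<m , refl =
      proj₁ (r-range (s + j) q≥1 q≤n) , proj₂ (r-range (s + j) q≥1 q≤n) ,
      prefix-convex prefix-s prefix-t (r-monotone s (s + j) s≥1 (m≤m+n s j) q≤n)
                                      (r-monotone (s + j) t q≥1 (shifted-index (m≤n⇒m≤1+n s≤t) j<m) t≤n)
      where
      q≥1 = proj₁ (inside j<m)
      q≤n = proj₂ (inside j<m)

  occ-≤-ranks : ∀ {x} s → (∀ {z} → IsOcc w x z → s ≤ p z) → occ w x ≤ suc n ∸ s
  occ-≤-ranks {x} s rank≥s =
    subst (occ w x ≤_) (length-applyUpTo rank (suc n ∸ s)) (occ-≤ covered)
    where
    rank : ℕ → ℕ
    rank j = r (s + j)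
    covered : ∀ {z} → IsOcc w x z → z ∈ applyUpTo rank (suc n ∸ s)
    covered {z} z-occ@(z≥1 , z≤len , _) =
      subst (_∈ applyUpTo rank (suc n ∸ s)) rank≡z
            (∈-applyUpTo⁺ rank (∸-monoˡ-< (s≤s (proj₂ (p-range z z≥1 z≤len))) (rank≥s z-occ)))
      where
      rank≡z : rank (p z ∸ s) ≡ z
      rank≡z = trans (cong r (m+[n∸m]≡n (rank≥s z-occ))) (r∘p z z≥1 z≤len)

  leftRank : ℕ → ℕ
  leftRank y = p (y ∸ 1)

  leftRank-range : ∀ y → 2 ≤ y → y ≤ n → 1 ≤ leftRank y × leftRank y ≤ n
  leftRank-range y y≥2 y≤n = p-range (y ∸ 1) (∸-monoˡ-≤ 1 y≥2) (≤-trans (m∸n≤m y 1) y≤n)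

  leftRank-monotone : ∀ {a} s t → 1 ≤ s → s < t → t ≤ n →
                      2 ≤ r s → symAt w (r s ∸ 1) ≡ just a → 2 ≤ r t → symAt w (r t ∸ 1) ≡ just a →
                      leftRank (r s) < leftRank (r t)
  leftRank-monotone s t s≥1 s<t t≤n rs≥2 letter-s rt≥2 letter-t =
    p-reflects (r s ∸ 1) (r t ∸ 1) (∸-monoˡ-≤ 1 rs≥2) (≤-trans (m∸n≤m (r s) 1) rs≤n)
                                   (∸-monoˡ-≤ 1 rt≥2) (≤-trans (m∸n≤m (r t) 1) rt≤n)
      (subst₂ _<ˡᵉˣ_ (sym (suffix-preceded w (r s) rs≥2 letter-s)) (sym (suffix-preceded w (r t) rt≥2 letter-t))
              (next refl (r-sorted s t s≥1 s<t t≤n)))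
    where
    rs≤n = proj₂ (r-range s s≥1 (≤-trans (<⇒≤ s<t) t≤n))
    rt≤n = proj₂ (r-range t (≤-trans s≥1 (<⇒≤ s<t)) t≤n)

  leftRank-suffix : ∀ {a} y → 2 ≤ y → y ≤ n → symAt w (y ∸ 1) ≡ just a →
                    suffix w (r (leftRank y)) ≡ a ∷ suffix w y
  leftRank-suffix y y≥2 y≤n letter =
    trans (cong (suffix w) (r∘p (y ∸ 1) (∸-monoˡ-≤ 1 y≥2) (≤-trans (m∸n≤m y 1) y≤n)))
          (suffix-preceded w y y≥2 letter)

module Block {σ} (w : Str σ) (r p : ℕ → ℕ) (u : Str σ) (k i : ℕ)
  (sa : IsSuffixArray w r) (inv : IsInverse (length w) r p)
  (occ≡k : occ w u ≡ k) (k≥2 : 2 ≤ k) (i≥1 : 1 ≤ i) (i<n : i < length w)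
  (block : ∀ t → 1 ≤ t → t ≤ length w → (OccursAt w u (r t) ⇔ ((i ≤ t) × (t ≤ i + k ∸ 1)))) where

  open SuffixArray w r p sa inv

  K : ℕ
  K = k ∸ 1

  e : ℕ
  e = i + k ∸ 1

  k≥1 : 1 ≤ k
  k≥1 = ≤-trans (n≤1+n 1) k≥2

  e≡i+K : e ≡ i + K
  e≡i+K = +-∸-assoc i k≥1

  rank≥i : ∀ {z} → IsOcc w u z → i ≤ p z
  rank≥i {z} z-occ@(z≥1 , z≤len , _) =
    proj₁ (Equivalence.to (block (p z) (proj₁ pz-range) (proj₂ pz-range))
                          (subst (OccursAt w u) (sym (r∘p z z≥1 z≤len)) (occ-occursAt z-occ)))
    where
    pz-range = p-range z z≥1 z≤len

  e≤n : e ≤ n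
  e≤n = begin
    i + k ∸ 1             ≤⟨ ∸-monoˡ-≤ 1 (+-monoʳ-≤ i k≤) ⟩
    i + (suc n ∸ i) ∸ 1   ≡⟨ cong (_∸ 1) (m+[n∸m]≡n (≤-trans (<⇒≤ i<n) (n≤1+n n))) ⟩
    n                     ∎
    where
    open ≤-Reasoning
    k≤ : k ≤ suc n ∸ i
    k≤ = subst (_≤ suc n ∸ i) occ≡k (occ-≤-ranks i rank≥i)

  InBlock : ℕ → Set
  InBlock t = i ≤ t × t ≤ e

  i≤e : i ≤ e
  i≤e = ≤-trans (m≤m+n i K) (≤-reflexive (sym e≡i+K))

  first : InBlock i
  first = ≤-refl , i≤e

  last : InBlock e
  last = i≤e , ≤-refl

  inBlock-range : ∀ {t} → InBlock t → 1 ≤ t × t ≤ n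
  inBlock-range (i≤t , t≤e) = ≤-trans i≥1 i≤t , ≤-trans t≤e e≤n

  inBlock-prefix : ∀ {t} → InBlock t → IsPrefix u (suffix w (r t))
  inBlock-prefix {t} t∈ = proj₂ (proj₂ (Equivalence.from (block t (proj₁ t-range) (proj₂ t-range)) t∈))
    where
    t-range = inBlock-range t∈

  inBlock-occ : ∀ {t} → InBlock t → IsOcc w u (r t)
  inBlock-occ t∈ = proj₁ rt-range , proj₂ rt-range , inBlock-prefix t∈
    where
    rt-range = r-range _ (proj₁ (inBlock-range t∈)) (proj₂ (inBlock-range t∈))

  inBlock-r≥2 : ∀ {t} → InBlock t → r t ≢ 1 → 2 ≤ r t
  inBlock-r≥2 t∈ rt≢1 =
    ≤∧≢⇒< (proj₁ (r-range _ (proj₁ (inBlock-range t∈)) (proj₂ (inBlock-range t∈)))) (λ eq → rt≢1 (sym eq))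

  inBlock-r≤n : ∀ {t} → InBlock t → r t ≤ n
  inBlock-r≤n t∈ = proj₂ (r-range _ (proj₁ (inBlock-range t∈)) (proj₂ (inBlock-range t∈)))

  Preceded : Fin σ → ℕ → Set
  Preceded a t = 2 ≤ r t × symAt w (r t ∸ 1) ≡ just a

  NotPreceded : Fin σ → ℕ → Set
  NotPreceded a t = r t ≡ 1 ⊎ symAt w (r t ∸ 1) ≢ just a

  notPreceded? : ∀ a t → Dec (NotPreceded a t)
  notPreceded? a t = (r t ≟ 1) ⊎-dec ¬? (Maybe.≡-dec Fin._≟_ (symAt w (r t ∸ 1)) (just a))

  preceded : ∀ {a t} → InBlock t → ¬ NotPreceded a t → Preceded a t
  preceded {a} {t} t∈ ¬np =
    inBlock-r≥2 t∈ (λ rt≡1 → ¬np (inj₁ rt≡1)) ,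
    decidable-stable (Maybe.≡-dec Fin._≟_ (symAt w (r t ∸ 1)) (just a)) (λ ≢a → ¬np (inj₂ ≢a))

  extension-prefix : ∀ {a t} → InBlock t → Preceded a t → IsPrefix (a ∷ u) (suffix w (r (leftRank (r t))))
  extension-prefix {a} t∈ (rt≥2 , letter) =
    subst (IsPrefix (a ∷ u)) (sym (leftRank-suffix _ rt≥2 (inBlock-r≤n t∈) letter)) (cong (a ∷_) (inBlock-prefix t∈))

  extension-range : ∀ {a t} → InBlock t → Preceded a t → 1 ≤ leftRank (r t) × leftRank (r t) ≤ n
  extension-range t∈ (rt≥2 , _) = leftRank-range _ rt≥2 (inBlock-r≤n t∈)

  shared-letter-not-maximal : 2 ≤ r i → 2 ≤ r e → symAt w (r i ∸ 1) ≡ symAt w (r e ∸ 1) →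
                              leftRank (r e) ≡ leftRank (r i) + K → ¬ MaximalLeft w u
  shared-letter-not-maximal ri≥2 re≥2 same gap ml
    with letter-exists w (r i ∸ 1) (∸-monoˡ-≤ 1 ri≥2) (≤-trans (m∸n≤m (r i) 1) (inBlock-r≤n first))
  ... | a , letter-i = <-irrefl refl (begin-strict
    k                                      ≡⟨ k≡gap ⟩
    suc (leftRank (r e)) ∸ leftRank (r i)  ≤⟨ interval-count _ _ (proj₁ (extension-range first pi))
                                                  ordered (proj₂ (extension-range last pe))
                                                  (extension-prefix first pi) (extension-prefix last pe) ⟩
    occ w (a ∷ u)                          <⟨ ml (a ∷ []) (λ ()) ⟩
    occ w u                                ≡⟨ occ≡k ⟩
    k                                      ∎)
    where
    open ≤-Reasoning
    pi : Preceded a i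
    pi = ri≥2 , letter-i
    pe : Preceded a e
    pe = re≥2 , trans (sym same) letter-i
    ordered : leftRank (r i) ≤ leftRank (r e)
    ordered = ≤-trans (m≤m+n _ K) (≤-reflexive (sym gap))
    k≡gap : k ≡ suc (leftRank (r e)) ∸ leftRank (r i)
    k≡gap = trans (sym (m+[n∸m]≡n k≥1)) (trans (sym (suc-difference (leftRank (r i)) K)) (cong (λ y → suc y ∸ leftRank (r i)) (sym gap)))

  -- if every occurrence in the block is preceded by a, the extended suffixes
  -- have increasing ranks inside a block of at most k ranks, so they fill it
  uniform-extension : ∀ {a} → NonEmpty u → (∀ {t} → InBlock t → Preceded a t) →
                      leftRank (r e) ≡ leftRank (r i) + K
  uniform-extension {a} u≢[] all-preceded = ≤-antisym upper lower
    where
    L : ℕ → ℕ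
    L t = leftRank (r t)

    offset : ∀ {m} → m ≤ K → InBlock (i + m)
    offset m≤K = m≤m+n i _ , ≤-trans (+-monoʳ-≤ i m≤K) (≤-reflexive (sym e≡i+K))

    spread : ∀ m → m ≤ K → L i + m ≤ L (i + m)
    spread zero    _   = ≤-reflexive (trans (+-identityʳ (L i)) (cong L (sym (+-identityʳ i))))
    spread (suc m) m<K = begin
      L i + suc m       ≡⟨ +-suc (L i) m ⟩
      suc (L i + m)     ≤⟨ s≤s (spread m (<⇒≤ m<K)) ⟩
      suc (L (i + m))   ≤⟨ leftRank-monotone (i + m) (i + suc m) (proj₁ (inBlock-range (offset (<⇒≤ m<K))))
                             (+-monoʳ-< i (n<1+n m)) (proj₂ (inBlock-range (offset m<K)))
                             (proj₁ here′) (proj₂ here′) (proj₁ next′) (proj₂ next′) ⟩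
      L (i + suc m)     ∎
      where
      open ≤-Reasoning
      here′ = all-preceded (offset (<⇒≤ m<K))
      next′ = all-preceded (offset m<K)

    lower : L i + K ≤ L e
    lower = subst (λ t → L i + K ≤ L t) (sym e≡i+K) (spread K ≤-refl)

    ordered : L i ≤ L e
    ordered = ≤-trans (m≤m+n (L i) K) lower

    count : suc (L e) ∸ L i ≤ suc K
    count = begin
      suc (L e) ∸ L i  ≤⟨ interval-count _ _ (proj₁ (extension-range first (all-preceded first))) ordered
                             (proj₂ (extension-range last (all-preceded last)))
                             (extension-prefix first (all-preceded first)) (extension-prefix last (all-preceded last)) ⟩
      occ w (a ∷ u)    ≤⟨ occ-cons-≤ w a u≢[] ⟩
      occ w u          ≡⟨ occ≡k ⟩
      k                ≡⟨ sym (m+[n∸m]≡n k≥1) ⟩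
      suc K            ∎
      where open ≤-Reasoning

    upper : L e ≤ L i + K
    upper = begin
      L e              ≡⟨ sym (m+[n∸m]≡n ordered) ⟩
      L i + (L e ∸ L i) ≤⟨ +-monoʳ-≤ (L i) (s≤s⁻¹ (subst (_≤ suc K) (+-∸-assoc 1 ordered) count)) ⟩
      L i + K          ∎
      where open ≤-Reasoning

  Boundary : Set
  Boundary =
    r i ≡ 1
    ⊎ r (i + k ∸ 1) ≡ 1
    ⊎ (r i > 1 × r (i + k ∸ 1) > 1 × symAt w (r i ∸ 1) ≢ symAt w (r (i + k ∸ 1) ∸ 1))
    ⊎ (r i > 1 × r (i + k ∸ 1) > 1 × (+ p (r (i + k ∸ 1) ∸ 1)) - (+ p (r i ∸ 1)) ≢ + (k ∸ 1))

  uniform-violates : ∀ {a} → NonEmpty u → (∀ {t} → InBlock t → Preceded a t) → ¬ Boundary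
  uniform-violates _ all-preceded (inj₁ ri≡1) = <-irrefl (sym ri≡1) (proj₁ (all-preceded first))
  uniform-violates _ all-preceded (inj₂ (inj₁ re≡1)) = <-irrefl (sym re≡1) (proj₁ (all-preceded last))
  uniform-violates _ all-preceded (inj₂ (inj₂ (inj₁ (_ , _ , differ)))) =
    differ (trans (proj₂ (all-preceded first)) (sym (proj₂ (all-preceded last))))
  uniform-violates u≢[] all-preceded (inj₂ (inj₂ (inj₂ (_ , _ , gap)))) =
    gap (difference-from-ℕ _ _ K (uniform-extension u≢[] all-preceded))

  letter-rarer : NonEmpty u → Boundary → ∀ a → occ w (a ∷ u) < occ w u
  letter-rarer u≢[] boundary a with anyUpTo? (λ t → (i ≤? t) ×-dec notPreceded? a t) (suc e)
  ... | yes (t , t<1+e , i≤t , np) = occ-cons-< w a u≢[] (inBlock-occ (i≤t , s≤s⁻¹ t<1+e)) np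
  ... | no none = ⊥-elim (uniform-violates u≢[] all-preceded boundary)
    where
    all-preceded : ∀ {t} → InBlock t → Preceded a t
    all-preceded {t} t∈@(i≤t , t≤e) = preceded t∈ (λ np → none (t , s≤s t≤e , i≤t , np))

  maximalLeft-of-boundary : MaximalRight w u → Boundary → MaximalLeft w u
  maximalLeft-of-boundary mr boundary with empty-or-nonempty u
  ... | inj₁ u≡[] = subst (λ y → MaximalRight w y → MaximalLeft w y) (sym u≡[]) (maximalLeft-empty w) mr
  ... | inj₂ u≢[] = maximalLeft-from-letters w (letter-rarer u≢[] boundary)

  boundary-of-maximalLeft : MaximalLeft w u → Boundary
  boundary-of-maximalLeft ml with r i ≟ 1 | r e ≟ 1
  ... | yes ri≡1 | _        = inj₁ ri≡1
  ... | no _     | yes re≡1 = inj₂ (inj₁ re≡1)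
  ... | no ri≢1  | no re≢1
    with Maybe.≡-dec Fin._≟_ (symAt w (r i ∸ 1)) (symAt w (r e ∸ 1))
       | (+ leftRank (r e)) - (+ leftRank (r i)) ℤ.≟ + K
  ...  | no differ | _       = inj₂ (inj₂ (inj₁ (inBlock-r≥2 first ri≢1 , inBlock-r≥2 last re≢1 , differ)))
  ...  | yes _     | no gap  = inj₂ (inj₂ (inj₂ (inBlock-r≥2 first ri≢1 , inBlock-r≥2 last re≢1 , gap)))
  ...  | yes same  | yes gap = ⊥-elim (shared-letter-not-maximal (inBlock-r≥2 first ri≢1) (inBlock-r≥2 last re≢1)
                                         same (difference-to-ℕ _ _ K gap) ml)

proposition3 : ∀ {σ : ℕ} (w : Str σ) (r p : ℕ → ℕ) (u : Str σ) (k i : ℕ) →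
    IsSuffixArray w r → IsInverse (length w) r p →
    MaximalRight w u → occ w u ≡ k → 2 ≤ k →
    1 ≤ i → i < length w →
    (∀ t → 1 ≤ t → t ≤ length w → (OccursAt w u (r t) ⇔ ((i ≤ t) × (t ≤ i + k ∸ 1)))) →
    MaximalLeft w u ⇔
      (r i ≡ 1
       ⊎ r (i + k ∸ 1) ≡ 1
       ⊎ (r i > 1 × r (i + k ∸ 1) > 1 × symAt w (r i ∸ 1) ≢ symAt w (r (i + k ∸ 1) ∸ 1))
       ⊎ (r i > 1 × r (i + k ∸ 1) > 1 ×
            (+ p (r (i + k ∸ 1) ∸ 1)) - (+ p (r i ∸ 1)) ≢ + (k ∸ 1)))
proposition3 w r p u k i sa inv mr occ≡k k≥2 i≥1 i<n block =
  mk⇔ boundary-of-maximalLeft (maximalLeft-of-boundary mr)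
  where open Block w r p u k i sa inv occ≡k k≥2 i≥1 i<n block
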